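{- Let $\alpha\ge\omega$ be a countable ordinal with Cantor normal form $\alpha=\omega^{\beta_1}\cdot c_1+\omega^{\beta_2}\cdot c_2+\dots+\omega^{\beta_l}\cdot c_l$, where $\beta_1>\beta_2>\dots>\beta_l\ge 0$ and $1\le c_i<\omega$. Then, viewing $\alpha$ as a linear order, $\mathsf{rk}(\alpha)=\omega\cdot\beta_1+\lfloor\log_2 c_1\rfloor$.
   Context: Let $\mathcal F$ be the class of finite linear orders (language $\{<\}$); then the countable structures considered are countable linear orders. Substructures are induced suborders. For a countable linear order $Y$, $\mathsf{age}(Y)$ is its set of finite suborders. If $A\le B$ and $|B\setminus A|=1$, $B$ is a prime extension of $A$. If $A\le B$, $A\le Y$, a realization of $B$ in $Y$ is some $C\le Y$ with $A\le C$ and an order isomorphism $B\to C$ fixing $A$ pointwise. For $F\in\mathsf{age}(Y)$: $\mathsf{rk}_Y(F)\ge 0$ always; $\mathsf{rk}_Y(F)\ge\alpha+1$ iff every prime extension $B$ of $F$ that is a finite linear order has a realization $C$ in $Y$ with $\mathsf{rk}_Y(C)\ge\alpha$; for limit $\alpha$, $\mathsf{rk}_Y(F)\ge\alpha$ iff $\mathsf{rk}_Y(F)\ge\beta$ for all $\beta<\alpha$; $\mathsf{rk}_Y(F)=\sup\{\alpha:\mathsf{rk}_Y(F)\ge\alpha\}$ (value $\infty$ if unbounded); $\mathsf{rk}(Y)=\mathsf{rk}_Y(\emptyset)$. -}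

module Defs where

open import Data.Nat as ℕ using (ℕ)
open import Data.Nat.Logarithm using (⌊log₂_⌋)
open import Data.Product using (Σ; ∃; _×_; _,_; proj₁; proj₂)
open import Data.List using (List; []; _∷_; _++_)
open import Data.List.Relation.Unary.All using (All)
open import Data.Unit using (⊤)
open import Data.Empty using (⊥)
open import Relation.Nullary using (¬_)
open import Relation.Binary.PropositionalEquality using (_≡_)

data Ord : Set where
  zer : Ord
  suc : Ord → Ord
  lim : (ℕ → Ord) → Ord

infix 4 _≤ₒ_ _<ₒ_
_≤ₒ_ : Ord → Ord → Set
_<ₒ_ : Ord → Ord → Set
zer   ≤ₒ y = ⊤
suc x ≤ₒ y = x <ₒ y
lim f ≤ₒ y = ∀ n → f n ≤ₒ y
x <ₒ zer   = ⊥
x <ₒ suc y = x ≤ₒ y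
x <ₒ lim f = ∃ λ n → x <ₒ f n

fromℕ : ℕ → Ord
fromℕ ℕ.zero    = zer
fromℕ (ℕ.suc n) = suc (fromℕ n)

ω : Ord
ω = lim fromℕ

infixl 6 _+ₒ_
infixl 7 _·ₒ_
_+ₒ_ : Ord → Ord → Ord
x +ₒ zer   = x
x +ₒ suc y = suc (x +ₒ y)
x +ₒ lim f = lim (λ n → x +ₒ f n)

_·ₒ_ : Ord → Ord → Ord
x ·ₒ zer   = zer
x ·ₒ suc y = x ·ₒ y +ₒ x
x ·ₒ lim f = lim (λ n → x ·ₒ f n)

ω^ : Ord → Ord
ω^ zer     = suc zer
ω^ (suc y) = ω^ y ·ₒ ω
ω^ (lim f) = lim (λ n → ω^ (f n))

-- Cantor normal form  ω^β₁·c₁ + ω^β₂·c₂ + … + ω^βₗ·cₗ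
-- given as a head term (β₁ , c₁) and the list of remaining terms.

cnfAcc : Ord → List (Ord × ℕ) → Ord
cnfAcc acc []             = acc
cnfAcc acc ((b , c) ∷ r)  = cnfAcc (acc +ₒ ω^ b ·ₒ fromℕ c) r

cnf : Ord → ℕ → List (Ord × ℕ) → Ord
cnf b c r = cnfAcc (ω^ b ·ₒ fromℕ c) r

Decreasing : Ord → List (Ord × ℕ) → Set
Decreasing b []              = ⊤
Decreasing b ((b' , c) ∷ r)  = (b' <ₒ b) × Decreasing b' r

-- The ordinal α viewed as a linear order: points are ordinals below α,
-- ordered by <ₒ (equality = mutual ≤ₒ).

Pt : Ord → Set
Pt α = Σ Ord (λ x → x <ₒ α)

Lt : (α : Ord) → Pt α → Pt α → Set
Lt α x y = proj₁ x <ₒ proj₁ y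

-- Rank of finite suborders F of α, listed in increasing order.
-- rk≥ α γ F  means  rk_α(F) ≥ γ, by recursion on γ.
-- A prime extension of F is determined (up to isomorphism over F) by the
-- gap where the new point goes, i.e. a splitting F = L ++ R; a realization
-- is a point y of α in that gap, giving C = L ++ y ∷ R.
rk≥ : (α : Ord) → Ord → List (Pt α) → Set
rk≥ α zer     F = ⊤
rk≥ α (suc γ) F = ∀ (L R : List (Pt α)) → F ≡ L ++ R →
                  Σ (Pt α) λ y → All (λ x → Lt α x y) L × All (λ z → Lt α y z) R × rk≥ α γ (L ++ y ∷ R)
rk≥ α (lim f) F = ∀ n → rk≥ α (f n) F

-- rk(α) = γ  (in particular rk(α) ≠ ∞)
RankIs : Ord → Ord → Set
RankIs α γ = rk≥ α γ [] × ¬ rk≥ α (suc γ) []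

-- Let gap γ be the order type an interval must have to receive a point of rank γ:
-- gap 0 = 0, gap (γ+1) = gap γ + 1 + gap γ (a point with an interval of type gap γ on
-- either side), and gap is continuous at limits. By induction on γ, a finite suborder F of α
-- has rank ≥ γ exactly when every gap of F, the two end gaps included, has type ≥ gap γ;
-- hence rk(α) ≥ γ iff gap γ ≤ α. For β > 0 one computes gap (ω·β + n) = ω^β·2ⁿ, while
-- ω^β₁·c₁ ≤ α < ω^β₁·(c₁+1); so the largest γ with gap γ ≤ α is ω·β₁ + ⌊log₂ c₁⌋.
module Submission where

open import Defs
open import Data.Nat as ℕ using (ℕ; zero; suc; z≤n; s≤s; _^_; ⌊_/2⌋; ⌈_/2⌉)
open import Data.Nat.Properties as ℕₚ using ()
open import Data.Nat.Logarithm using (⌊log₂_⌋; ⌊log₂⌋-mono-≤; ⌊log₂[2^n]⌋≡n)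
open import Data.Nat.Logarithm.Core using (⌊log2⌋)
open import Data.Nat.Induction using (<-wellFounded)
open import Induction.WellFounded using (Acc; acc)
open import Data.Product using (Σ; _×_; _,_; proj₁; proj₂)
open import Data.List using (List; []; _∷_; _++_)
open import Data.List.Relation.Unary.All using (All; []; _∷_) renaming (map to All-map)
open import Data.List.Relation.Unary.All.Properties using (++⁻ʳ)
open import Data.Unit using (tt)
open import Relation.Nullary using (¬_; yes; no)
open import Relation.Binary.Structures using (IsPreorder)
open import Relation.Binary.PropositionalEquality
  using (_≡_; refl; sym; cong; subst; isEquivalence; resp₂)

-- Order and arithmetic on Brouwer ordinals

≤-lim : ∀ x f n → x ≤ₒ f n → x ≤ₒ lim f
≤-lim zer     f n p   = tt
≤-lim (suc x) f n p   = n , p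
≤-lim (lim g) f n p m = ≤-lim (g m) f n (p m)

≤-refl : ∀ x → x ≤ₒ x
≤-refl zer       = tt
≤-refl (suc x)   = ≤-refl x
≤-refl (lim f) n = ≤-lim (f n) f n (≤-refl (f n))

≤-reflexive : ∀ {x y} → x ≡ y → x ≤ₒ y
≤-reflexive {x} refl = ≤-refl x

f≤lim : ∀ f n → f n ≤ₒ lim f
f≤lim f n = ≤-lim (f n) f n (≤-refl (f n))

<⇒≤ : ∀ x y → x <ₒ y → x ≤ₒ y
≤⇒≤suc : ∀ x y → x ≤ₒ y → x ≤ₒ suc y
<⇒≤ x (suc y) p       = ≤⇒≤suc x y p
<⇒≤ x (lim g) (n , p) = ≤-lim x g n (<⇒≤ x (g n) p)
≤⇒≤suc zer     y p   = tt
≤⇒≤suc (suc x) y p   = <⇒≤ x y p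
≤⇒≤suc (lim f) y p n = ≤⇒≤suc (f n) y (p n)

x≤suc[x] : ∀ x → x ≤ₒ suc x
x≤suc[x] x = ≤⇒≤suc x x (≤-refl x)

≤-trans : ∀ x y z → x ≤ₒ y → y ≤ₒ z → x ≤ₒ z
<-≤-trans : ∀ x y z → x <ₒ y → y ≤ₒ z → x <ₒ z
≤-<-trans : ∀ x y z → x ≤ₒ y → y <ₒ z → x <ₒ z
≤-trans zer     y z p q   = tt
≤-trans (suc x) y z p q   = <-≤-trans x y z p q
≤-trans (lim f) y z p q n = ≤-trans (f n) y z (p n) q
<-≤-trans x (suc y) z p       q = ≤-<-trans x y z p q
<-≤-trans x (lim g) z (n , p) q = <-≤-trans x (g n) z p (q n)
≤-<-trans x y (suc z) p q       = ≤-trans x y z p q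
≤-<-trans x y (lim h) p (n , q) = n , ≤-<-trans x y (h n) p q

<-trans : ∀ x y z → x <ₒ y → y <ₒ z → x <ₒ z
<-trans x y z p = ≤-<-trans x y z (<⇒≤ x y p)

<-irrefl : ∀ x → ¬ x <ₒ x
<-irrefl (suc x) p       = <-irrefl x p
<-irrefl (lim f) (n , p) = <-irrefl (f n) (≤-<-trans (f n) (lim f) (f n) (f≤lim f n) p)

lim-mono-≤ : ∀ f g → (∀ n → f n ≤ₒ g n) → lim f ≤ₒ lim g
lim-mono-≤ f g p n = ≤-lim (f n) g n (p n)

module ≤ₒ-Reasoning where
  private
    ≤ₒ-isPreorder : IsPreorder _≡_ _≤ₒ_
    ≤ₒ-isPreorder = record
      { isEquivalence = isEquivalence
      ; reflexive     = ≤-reflexive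
      ; trans         = λ {x} {y} {z} → ≤-trans x y z
      }

  open import Relation.Binary.Reasoning.Base.Triple
    ≤ₒ-isPreorder
    (λ {x} {y} p q → <-irrefl x (<-trans x y x p q))
    (λ {x} {y} {z} → <-trans x y z)
    (resp₂ _<ₒ_)
    (λ {x} {y} → <⇒≤ x y)
    (λ {x} {y} {z} → <-≤-trans x y z)
    (λ {x} {y} {z} → ≤-<-trans x y z)
    public
    hiding (step-≈; step-≈˘; step-≈-⟩; step-≈-⟨)

x≤x+y : ∀ x y → x ≤ₒ x +ₒ y
x≤x+y x zer     = ≤-refl x
x≤x+y x (suc y) = ≤⇒≤suc x (x +ₒ y) (x≤x+y x y)
x≤x+y x (lim f) = ≤-lim x (λ n → x +ₒ f n) 0 (x≤x+y x (f 0))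

+-monoʳ-≤ : ∀ x y z → y ≤ₒ z → x +ₒ y ≤ₒ x +ₒ z
+-monoʳ-< : ∀ x y z → y <ₒ z → x +ₒ y <ₒ x +ₒ z
+-monoʳ-≤ x zer     z p   = x≤x+y x z
+-monoʳ-≤ x (suc y) z p   = +-monoʳ-< x y z p
+-monoʳ-≤ x (lim f) z p n = +-monoʳ-≤ x (f n) z (p n)
+-monoʳ-< x y (suc z) p       = +-monoʳ-≤ x y z p
+-monoʳ-< x y (lim g) (n , p) = n , +-monoʳ-< x y (g n) p

+-monoˡ-≤ : ∀ x y z → x ≤ₒ y → x +ₒ z ≤ₒ y +ₒ z
+-monoˡ-≤ x y zer     p = p
+-monoˡ-≤ x y (suc z) p = +-monoˡ-≤ x y z p
+-monoˡ-≤ x y (lim g) p =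
  lim-mono-≤ (λ n → x +ₒ g n) (λ n → y +ₒ g n) (λ n → +-monoˡ-≤ x y (g n) p)

+-mono-≤ : ∀ x y u v → x ≤ₒ y → u ≤ₒ v → x +ₒ u ≤ₒ y +ₒ v
+-mono-≤ x y u v p q = ≤-trans (x +ₒ u) (y +ₒ u) (y +ₒ v) (+-monoˡ-≤ x y u p) (+-monoʳ-≤ y u v q)

+-assoc-≤ : ∀ x y z → (x +ₒ y) +ₒ z ≤ₒ x +ₒ (y +ₒ z)
+-assoc-≤ x y zer     = ≤-refl (x +ₒ y)
+-assoc-≤ x y (suc z) = +-assoc-≤ x y z
+-assoc-≤ x y (lim f) =
  lim-mono-≤ (λ n → (x +ₒ y) +ₒ f n) (λ n → x +ₒ (y +ₒ f n)) (λ n → +-assoc-≤ x y (f n))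

+-assoc-≥ : ∀ x y z → x +ₒ (y +ₒ z) ≤ₒ (x +ₒ y) +ₒ z
+-assoc-≥ x y zer     = ≤-refl (x +ₒ y)
+-assoc-≥ x y (suc z) = +-assoc-≥ x y z
+-assoc-≥ x y (lim f) =
  lim-mono-≤ (λ n → x +ₒ (y +ₒ f n)) (λ n → (x +ₒ y) +ₒ f n) (λ n → +-assoc-≥ x y (f n))

0+x≤x : ∀ x → zer +ₒ x ≤ₒ x
0+x≤x zer     = tt
0+x≤x (suc x) = 0+x≤x x
0+x≤x (lim f) = lim-mono-≤ (λ n → zer +ₒ f n) f (λ n → 0+x≤x (f n))

x≤0+x : ∀ x → x ≤ₒ zer +ₒ x
x≤0+x zer     = tt
x≤0+x (suc x) = x≤0+x x
x≤0+x (lim f) = lim-mono-≤ f (λ n → zer +ₒ f n) (λ n → x≤0+x (f n))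

fromℕ-mono-≤ : ∀ {m n} → m ℕ.≤ n → fromℕ m ≤ₒ fromℕ n
fromℕ-mono-≤ z≤n     = tt
fromℕ-mono-≤ (s≤s p) = fromℕ-mono-≤ p

·-monoʳ-≤ : ∀ M {m n} → m ℕ.≤ n → M ·ₒ fromℕ m ≤ₒ M ·ₒ fromℕ n
·-monoʳ-≤ M z≤n = tt
·-monoʳ-≤ M {suc m} {suc n} (s≤s p) =
  +-monoˡ-≤ (M ·ₒ fromℕ m) (M ·ₒ fromℕ n) M (·-monoʳ-≤ M p)

·-monoˡ-≤ : ∀ X Y n → X ≤ₒ Y → X ·ₒ fromℕ n ≤ₒ Y ·ₒ fromℕ n
·-monoˡ-≤ X Y zero    p = tt
·-monoˡ-≤ X Y (suc n) p = +-mono-≤ (X ·ₒ fromℕ n) (Y ·ₒ fromℕ n) X Y (·-monoˡ-≤ X Y n p) p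

·-distribˡ-+-≤ : ∀ M m n → M ·ₒ fromℕ m +ₒ M ·ₒ fromℕ n ≤ₒ M ·ₒ fromℕ (n ℕ.+ m)
·-distribˡ-+-≤ M m zero    = ≤-refl (M ·ₒ fromℕ m)
·-distribˡ-+-≤ M m (suc n) = begin
  M ·ₒ fromℕ m +ₒ (M ·ₒ fromℕ n +ₒ M)  ≤⟨ +-assoc-≥ (M ·ₒ fromℕ m) (M ·ₒ fromℕ n) M ⟩
  M ·ₒ fromℕ m +ₒ M ·ₒ fromℕ n +ₒ M    ≤⟨ +-monoˡ-≤ _ (M ·ₒ fromℕ (n ℕ.+ m)) M (·-distribˡ-+-≤ M m n) ⟩
  M ·ₒ fromℕ (n ℕ.+ m) +ₒ M            ∎
  where open ≤ₒ-Reasoning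

·-distribˡ-+-≥ : ∀ M m n → M ·ₒ fromℕ (n ℕ.+ m) ≤ₒ M ·ₒ fromℕ m +ₒ M ·ₒ fromℕ n
·-distribˡ-+-≥ M m zero    = ≤-refl (M ·ₒ fromℕ m)
·-distribˡ-+-≥ M m (suc n) = begin
  M ·ₒ fromℕ (n ℕ.+ m) +ₒ M            ≤⟨ +-monoˡ-≤ _ (M ·ₒ fromℕ m +ₒ M ·ₒ fromℕ n) M (·-distribˡ-+-≥ M m n) ⟩
  M ·ₒ fromℕ m +ₒ M ·ₒ fromℕ n +ₒ M    ≤⟨ +-assoc-≤ (M ·ₒ fromℕ m) (M ·ₒ fromℕ n) M ⟩
  M ·ₒ fromℕ m +ₒ (M ·ₒ fromℕ n +ₒ M)  ∎
  where open ≤ₒ-Reasoning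

·2^suc≡·[2^+2^] : ∀ M n → M ·ₒ fromℕ (2 ^ suc n) ≡ M ·ₒ fromℕ (2 ^ n ℕ.+ 2 ^ n)
·2^suc≡·[2^+2^] M n = cong (λ k → M ·ₒ fromℕ (2 ^ n ℕ.+ k)) (ℕₚ.+-identityʳ (2 ^ n))

1+M≤M⇒1+M·k≤M·k : ∀ M → fromℕ 1 +ₒ M ≤ₒ M → ∀ k → 1 ℕ.≤ k →
                   fromℕ 1 +ₒ M ·ₒ fromℕ k ≤ₒ M ·ₒ fromℕ k
1+M≤M⇒1+M·k≤M·k M 1+M≤M (suc zero) _ = begin
  fromℕ 1 +ₒ (zer +ₒ M)  ≤⟨ +-monoʳ-≤ (fromℕ 1) (zer +ₒ M) M (0+x≤x M) ⟩
  fromℕ 1 +ₒ M           ≤⟨ 1+M≤M ⟩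
  M                      ≤⟨ x≤0+x M ⟩
  zer +ₒ M               ∎
  where open ≤ₒ-Reasoning
1+M≤M⇒1+M·k≤M·k M 1+M≤M (suc k@(suc _)) _ = begin
  fromℕ 1 +ₒ (M ·ₒ fromℕ k +ₒ M)  ≤⟨ +-assoc-≥ (fromℕ 1) (M ·ₒ fromℕ k) M ⟩
  fromℕ 1 +ₒ M ·ₒ fromℕ k +ₒ M    ≤⟨ +-monoˡ-≤ _ (M ·ₒ fromℕ k) M (1+M≤M⇒1+M·k≤M·k M 1+M≤M k (s≤s z≤n)) ⟩
  M ·ₒ fromℕ k +ₒ M               ∎
  where open ≤ₒ-Reasoning

x-then-y : Ord → Ord → ℕ → Ord
x-then-y x y zero    = x
x-then-y x y (suc _) = y

infixl 5 _⊔ₒ_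
_⊔ₒ_ : Ord → Ord → Ord
x ⊔ₒ y = lim (x-then-y x y)

⊔-lub : ∀ x y z → x ≤ₒ z → y ≤ₒ z → x ⊔ₒ y ≤ₒ z
⊔-lub x y z p q zero    = p
⊔-lub x y z p q (suc _) = q

x≤x⊔y : ∀ x y → x ≤ₒ x ⊔ₒ y
x≤x⊔y x y = f≤lim (x-then-y x y) 0

y≤x⊔y : ∀ x y → y ≤ₒ x ⊔ₒ y
y≤x⊔y x y = f≤lim (x-then-y x y) 1

⊔-monoˡ-≤ : ∀ x x′ y → x ≤ₒ x′ → x ⊔ₒ y ≤ₒ x′ ⊔ₒ y
⊔-monoˡ-≤ x x′ y p = ⊔-lub x y (x′ ⊔ₒ y) (≤-trans x x′ _ p (x≤x⊔y x′ y)) (y≤x⊔y x′ y)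

0<ω^ : ∀ β → zer <ₒ ω^ β
0<ω^ zer     = tt
0<ω^ (suc β) = 1 , <-≤-trans zer (ω^ β) (zer +ₒ ω^ β) (0<ω^ β) (x≤0+x (ω^ β))
0<ω^ (lim f) = 0 , 0<ω^ (f 0)

1<ω^β⇒0<β : ∀ β → fromℕ 1 <ₒ ω^ β → zer <ₒ β
1<ω^β⇒0<β zer     p       = p
1<ω^β⇒0<β (suc β) p       = tt
1<ω^β⇒0<β (lim f) (n , p) = n , 1<ω^β⇒0<β (f n) p

ω^-mono-≤ : ∀ x y → x ≤ₒ y → ω^ x ≤ₒ ω^ y
ω^·n≤ω^ : ∀ x y → x <ₒ y → ∀ n → ω^ x ·ₒ fromℕ n ≤ₒ ω^ y
ω^-mono-≤ zer     y p   = 0<ω^ y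
ω^-mono-≤ (suc x) y p n = ω^·n≤ω^ x y p n
ω^-mono-≤ (lim f) y p n = ω^-mono-≤ (f n) y (p n)
ω^·n≤ω^ x (suc y) p n = ≤-trans (ω^ x ·ₒ fromℕ n) (ω^ y ·ₒ fromℕ n) _
  (·-monoˡ-≤ (ω^ x) (ω^ y) n (ω^-mono-≤ x y p)) (f≤lim (λ m → ω^ y ·ₒ fromℕ m) n)
ω^·n≤ω^ x (lim g) (j , p) n = ≤-trans (ω^ x ·ₒ fromℕ n) (ω^ (g j)) _
  (ω^·n≤ω^ x (g j) p n) (f≤lim (λ m → ω^ (g m)) j)

-- ω^β is either 1 or a limit; the join with ω covers both cases without deciding which.
1+ω^β≤ω^β⊔ω : ∀ β → fromℕ 1 +ₒ ω^ β ≤ₒ ω^ β ⊔ₒ ω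
1+ω^β≤ω^β⊔ω zer = ≤-trans (fromℕ 2) ω _ (2 , ≤-refl (fromℕ 1)) (y≤x⊔y (fromℕ 1) ω)
1+ω^β≤ω^β⊔ω (suc β) m = begin
  fromℕ 1 +ₒ M ·ₒ fromℕ m         ≤⟨ +-monoˡ-≤ (fromℕ 1) (zer +ₒ M) (M ·ₒ fromℕ m) (<-≤-trans zer M _ (0<ω^ β) (x≤0+x M)) ⟩
  (zer +ₒ M) +ₒ M ·ₒ fromℕ m      ≤⟨ ·-distribˡ-+-≤ M 1 m ⟩
  M ·ₒ fromℕ (m ℕ.+ 1)            ≤⟨ f≤lim (λ k → M ·ₒ fromℕ k) (m ℕ.+ 1) ⟩
  ω^ (suc β)                      ≤⟨ x≤x⊔y (ω^ (suc β)) ω ⟩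
  ω^ (suc β) ⊔ₒ ω                 ∎
  where
  M = ω^ β
  open ≤ₒ-Reasoning
1+ω^β≤ω^β⊔ω (lim f) n = begin
  fromℕ 1 +ₒ ω^ (f n)   ≤⟨ 1+ω^β≤ω^β⊔ω (f n) ⟩
  ω^ (f n) ⊔ₒ ω         ≤⟨ ⊔-monoˡ-≤ (ω^ (f n)) (ω^ (lim f)) ω (f≤lim (λ k → ω^ (f k)) n) ⟩
  ω^ (lim f) ⊔ₒ ω       ∎
  where open ≤ₒ-Reasoning

1+ω^β≤ω^β : ∀ β → ω ≤ₒ ω^ β → fromℕ 1 +ₒ ω^ β ≤ₒ ω^ β
1+ω^β≤ω^β β ω≤ω^β = ≤-trans (fromℕ 1 +ₒ ω^ β) (ω^ β ⊔ₒ ω) (ω^ β)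
  (1+ω^β≤ω^β⊔ω β) (⊔-lub (ω^ β) ω (ω^ β) (≤-refl (ω^ β)) ω≤ω^β)

-- The gap function

gap : Ord → Ord
gap zer     = zer
gap (suc γ) = suc (gap γ) +ₒ gap γ
gap (lim f) = lim (λ n → gap (f n))

gap-≤-suc : ∀ γ → gap γ ≤ₒ gap (suc γ)
gap-≤-suc γ = ≤-trans (gap γ) (zer +ₒ gap γ) (gap (suc γ))
  (x≤0+x (gap γ)) (+-monoˡ-≤ zer (suc (gap γ)) (gap γ) tt)

gap-≤-+ℕ : ∀ x n → gap x ≤ₒ gap (x +ₒ fromℕ n)
gap-≤-+ℕ x zero    = ≤-refl (gap x)
gap-≤-+ℕ x (suc n) = ≤-trans (gap x) (gap (x +ₒ fromℕ n)) _ (gap-≤-+ℕ x n) (gap-≤-suc (x +ₒ fromℕ n))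

n≤gap[x+n] : ∀ x n → fromℕ n ≤ₒ gap (x +ₒ fromℕ n)
n≤gap[x+n] x zero    = tt
n≤gap[x+n] x (suc n) = ≤-<-trans (fromℕ n) T (suc T +ₒ T)
  (n≤gap[x+n] x n) (<-≤-trans T (suc T) (suc T +ₒ T) (≤-refl T) (x≤x+y (suc T) T))
  where T = gap (x +ₒ fromℕ n)

ω≤gap[ω·β] : ∀ β → zer <ₒ β → ω ≤ₒ gap (ω ·ₒ β)
ω≤gap[ω·β] (suc β) _ m = ≤-lim (fromℕ m) (λ n → gap (ω ·ₒ β +ₒ fromℕ n)) m (n≤gap[x+n] (ω ·ₒ β) m)
ω≤gap[ω·β] (lim f) (j , p) = ≤-trans ω (gap (ω ·ₒ f j)) (gap (ω ·ₒ lim f))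
  (ω≤gap[ω·β] (f j) p) (f≤lim (λ m → gap (ω ·ₒ f m)) j)

suc-gap[x+n]≤M·2^[1+n] : ∀ x M → gap x ≤ₒ M → zer <ₒ M → ∀ n →
                         suc (gap (x +ₒ fromℕ n)) ≤ₒ M ·ₒ fromℕ (2 ^ suc n)
suc-gap[x+n]≤M·2^[1+n] x M gap≤M 0<M zero =
  ≤-<-trans (gap x) (zer +ₒ M) (zer +ₒ M +ₒ M) (≤-trans (gap x) M _ gap≤M (x≤0+x M)) (+-monoʳ-< (zer +ₒ M) zer M 0<M)
suc-gap[x+n]≤M·2^[1+n] x M gap≤M 0<M (suc n) = begin
  suc T +ₒ suc T                       ≤⟨ +-mono-≤ (suc T) X (suc T) X IH IH ⟩
  X +ₒ X                               ≤⟨ ·-distribˡ-+-≤ M (2 ^ suc n) (2 ^ suc n) ⟩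
  M ·ₒ fromℕ (2 ^ suc n ℕ.+ 2 ^ suc n) ≡⟨ ·2^suc≡·[2^+2^] M (suc n) ⟨
  M ·ₒ fromℕ (2 ^ suc (suc n))         ∎
  where
  open ≤ₒ-Reasoning
  T = gap (x +ₒ fromℕ n)
  X = M ·ₒ fromℕ (2 ^ suc n)
  IH = suc-gap[x+n]≤M·2^[1+n] x M gap≤M 0<M n

gap[ω·β]≤ω^β : ∀ β → gap (ω ·ₒ β) ≤ₒ ω^ β
gap[ω·β]≤ω^β zer       = tt
gap[ω·β]≤ω^β (suc β) n = ≤-lim (gap (ω ·ₒ β +ₒ fromℕ n)) (λ m → ω^ β ·ₒ fromℕ m) (2 ^ suc n)
  (<⇒≤ (gap (ω ·ₒ β +ₒ fromℕ n)) (ω^ β ·ₒ fromℕ (2 ^ suc n)) (suc-gap[x+n]≤M·2^[1+n] (ω ·ₒ β) (ω^ β) (gap[ω·β]≤ω^β β) (0<ω^ β) n))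
gap[ω·β]≤ω^β (lim f)   =
  lim-mono-≤ (λ n → gap (ω ·ₒ f n)) (λ n → ω^ (f n)) (λ n → gap[ω·β]≤ω^β (f n))

gap[x+n]≤M·2ⁿ : ∀ x M → gap x ≤ₒ M → fromℕ 1 +ₒ M ≤ₒ M → ∀ n →
                gap (x +ₒ fromℕ n) ≤ₒ M ·ₒ fromℕ (2 ^ n)
gap[x+n]≤M·2ⁿ x M gap≤M 1+M≤M zero    = ≤-trans (gap x) M (zer +ₒ M) gap≤M (x≤0+x M)
gap[x+n]≤M·2ⁿ x M gap≤M 1+M≤M (suc n) = begin
  suc T +ₒ T                          ≤⟨ +-mono-≤ (suc T) (suc X) T X IH IH ⟩
  suc X +ₒ X                          ≤⟨ +-assoc-≤ X (fromℕ 1) X ⟩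
  X +ₒ (fromℕ 1 +ₒ X)                 ≤⟨ +-monoʳ-≤ X (fromℕ 1 +ₒ X) X (1+M≤M⇒1+M·k≤M·k M 1+M≤M (2 ^ n) (ℕₚ.m^n>0 2 n)) ⟩
  X +ₒ X                              ≤⟨ ·-distribˡ-+-≤ M (2 ^ n) (2 ^ n) ⟩
  M ·ₒ fromℕ (2 ^ n ℕ.+ 2 ^ n)        ≡⟨ ·2^suc≡·[2^+2^] M n ⟨
  M ·ₒ fromℕ (2 ^ suc n)              ∎
  where
  open ≤ₒ-Reasoning
  T = gap (x +ₒ fromℕ n)
  X = M ·ₒ fromℕ (2 ^ n)
  IH = gap[x+n]≤M·2ⁿ x M gap≤M 1+M≤M n

M·n≤gap[x+n] : ∀ x M → M ≤ₒ suc (gap x) → ∀ n → M ·ₒ fromℕ n ≤ₒ gap (x +ₒ fromℕ n)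
M·n≤gap[x+n] x M M≤ zero    = tt
M·n≤gap[x+n] x M M≤ (suc n) = begin
  M ·ₒ fromℕ (suc n)             ≡⟨ cong (λ k → M ·ₒ fromℕ k) (ℕₚ.+-comm 1 n) ⟩
  M ·ₒ fromℕ (n ℕ.+ 1)           ≤⟨ ·-distribˡ-+-≥ M 1 n ⟩
  (zer +ₒ M) +ₒ M ·ₒ fromℕ n     ≤⟨ +-mono-≤ (zer +ₒ M) (suc T) (M ·ₒ fromℕ n) T M≤sucT
                                      (M·n≤gap[x+n] x M M≤ n) ⟩
  suc T +ₒ T                     ∎
  where
  open ≤ₒ-Reasoning
  T = gap (x +ₒ fromℕ n)
  M≤sucT : zer +ₒ M ≤ₒ suc T
  M≤sucT = begin
    zer +ₒ M      ≤⟨ 0+x≤x M ⟩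
    M             ≤⟨ M≤ ⟩
    suc (gap x)   ≤⟨ gap-≤-+ℕ x n ⟩
    suc T         ∎

M·2ⁿ≤gap[x+n] : ∀ x M → M ≤ₒ gap x → ∀ n → M ·ₒ fromℕ (2 ^ n) ≤ₒ gap (x +ₒ fromℕ n)
M·2ⁿ≤gap[x+n] x M M≤gap zero    = ≤-trans (zer +ₒ M) M (gap x) (0+x≤x M) M≤gap
M·2ⁿ≤gap[x+n] x M M≤gap (suc n) = begin
  M ·ₒ fromℕ (2 ^ suc n)          ≡⟨ ·2^suc≡·[2^+2^] M n ⟩
  M ·ₒ fromℕ (2 ^ n ℕ.+ 2 ^ n)    ≤⟨ ·-distribˡ-+-≥ M (2 ^ n) (2 ^ n) ⟩
  X +ₒ X                          ≤⟨ +-mono-≤ X (suc T) X T (≤-trans X T (suc T) IH (x≤suc[x] T)) IH ⟩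
  suc T +ₒ T                      ∎
  where
  open ≤ₒ-Reasoning
  T = gap (x +ₒ fromℕ n)
  X = M ·ₒ fromℕ (2 ^ n)
  IH = M·2ⁿ≤gap[x+n] x M M≤gap n

ω^β≤suc-gap[ω·β] : ∀ β → ω^ β ≤ₒ suc (gap (ω ·ₒ β))
ω^[1+β]≤gap[ω·[1+β]] : ∀ β → ω^ (suc β) ≤ₒ gap (ω ·ₒ suc β)
ω^[1+β]≤gap[ω·[1+β]] β m = ≤-lim (ω^ β ·ₒ fromℕ m) (λ n → gap (ω ·ₒ β +ₒ fromℕ n)) m
  (M·n≤gap[x+n] (ω ·ₒ β) (ω^ β) (ω^β≤suc-gap[ω·β] β) m)
ω^β≤suc-gap[ω·β] zer       = tt
ω^β≤suc-gap[ω·β] (suc β)   =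
  ≤⇒≤suc (ω^ (suc β)) (gap (ω ·ₒ suc β)) (ω^[1+β]≤gap[ω·[1+β]] β)
ω^β≤suc-gap[ω·β] (lim f) n = ≤-trans (ω^ (f n)) (suc (gap (ω ·ₒ f n))) (suc (gap (ω ·ₒ lim f)))
  (ω^β≤suc-gap[ω·β] (f n)) (f≤lim (λ m → gap (ω ·ₒ f m)) n)

ω^β≤gap[ω·β]⊔ω : ∀ β → ω^ β ≤ₒ gap (ω ·ₒ β) ⊔ₒ ω
ω^β≤gap[ω·β]⊔ω zer       = 1 , 1 , tt
ω^β≤gap[ω·β]⊔ω (suc β)   = ≤-trans (ω^ (suc β)) (gap (ω ·ₒ suc β)) _
  (ω^[1+β]≤gap[ω·[1+β]] β) (x≤x⊔y (gap (ω ·ₒ suc β)) ω)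
ω^β≤gap[ω·β]⊔ω (lim f) n = ≤-trans (ω^ (f n)) (gap (ω ·ₒ f n) ⊔ₒ ω) (gap (ω ·ₒ lim f) ⊔ₒ ω)
  (ω^β≤gap[ω·β]⊔ω (f n)) (⊔-monoˡ-≤ (gap (ω ·ₒ f n)) (gap (ω ·ₒ lim f)) ω (f≤lim (λ m → gap (ω ·ₒ f m)) n))

ω^β≤gap[ω·β] : ∀ β → zer <ₒ β → ω^ β ≤ₒ gap (ω ·ₒ β)
ω^β≤gap[ω·β] β 0<β = ≤-trans (ω^ β) (gap (ω ·ₒ β) ⊔ₒ ω) (gap (ω ·ₒ β))
  (ω^β≤gap[ω·β]⊔ω β) (⊔-lub (gap (ω ·ₒ β)) ω (gap (ω ·ₒ β)) (≤-refl (gap (ω ·ₒ β))) (ω≤gap[ω·β] β 0<β))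

gap[ω·β+n]≤ω^β·2ⁿ : ∀ β → zer <ₒ β → ∀ n → gap (ω ·ₒ β +ₒ fromℕ n) ≤ₒ ω^ β ·ₒ fromℕ (2 ^ n)
gap[ω·β+n]≤ω^β·2ⁿ β 0<β = gap[x+n]≤M·2ⁿ (ω ·ₒ β) (ω^ β) (gap[ω·β]≤ω^β β) (1+ω^β≤ω^β β ω≤ω^β)
  where
  ω≤ω^β : ω ≤ₒ ω^ β
  ω≤ω^β = ≤-trans ω (gap (ω ·ₒ β)) (ω^ β) (ω≤gap[ω·β] β 0<β) (gap[ω·β]≤ω^β β)

ω^β·2ⁿ≤gap[ω·β+n] : ∀ β → zer <ₒ β → ∀ n → ω^ β ·ₒ fromℕ (2 ^ n) ≤ₒ gap (ω ·ₒ β +ₒ fromℕ n)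
ω^β·2ⁿ≤gap[ω·β+n] β 0<β = M·2ⁿ≤gap[x+n] (ω ·ₒ β) (ω^ β) (ω^β≤gap[ω·β] β 0<β)

2^⌊log₂n⌋≤n : ∀ n → 1 ℕ.≤ n → 2 ^ ⌊log₂ n ⌋ ℕ.≤ n
2^⌊log₂n⌋≤n n = go n (<-wellFounded n)
  where
  go : ∀ n (rec : Acc ℕ._<_ n) → 1 ℕ.≤ n → 2 ^ ⌊log2⌋ n rec ℕ.≤ n
  go (suc zero)        _        _ = ℕₚ.≤-refl
  go n@(suc (suc m)) (acc rs) _ =
    double (⌊log2⌋ ⌊ n /2⌋ (rs half<n)) (go ⌊ n /2⌋ (rs half<n) (s≤s z≤n))
    where
    half<n = ℕₚ.⌊n/2⌋<n (suc m)
    double : ∀ k → 2 ^ k ℕ.≤ ⌊ n /2⌋ → 2 ^ suc k ℕ.≤ n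
    double k p = begin
      2 ^ k ℕ.+ (2 ^ k ℕ.+ 0)          ≤⟨ ℕₚ.+-mono-≤ p (ℕₚ.+-monoˡ-≤ 0 p) ⟩
      ⌊ n /2⌋ ℕ.+ (⌊ n /2⌋ ℕ.+ 0)      ≡⟨ cong (⌊ n /2⌋ ℕ.+_) (ℕₚ.+-identityʳ ⌊ n /2⌋) ⟩
      ⌊ n /2⌋ ℕ.+ ⌊ n /2⌋              ≤⟨ ℕₚ.+-monoʳ-≤ ⌊ n /2⌋ (ℕₚ.⌊n/2⌋≤⌈n/2⌉ n) ⟩
      ⌊ n /2⌋ ℕ.+ ⌈ n /2⌉              ≡⟨ ℕₚ.⌊n/2⌋+⌈n/2⌉≡n n ⟩
      n                                ∎
      where open ℕₚ.≤-Reasoning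

n<2^[1+⌊log₂n⌋] : ∀ n → n ℕ.< 2 ^ suc ⌊log₂ n ⌋
n<2^[1+⌊log₂n⌋] n = ℕₚ.≰⇒> λ 2^[1+k]≤n →
  ℕₚ.1+n≰n (subst (ℕ._≤ ⌊log₂ n ⌋) (⌊log₂[2^n]⌋≡n (suc ⌊log₂ n ⌋)) (⌊log₂⌋-mono-≤ 2^[1+k]≤n))

-- Cantor normal forms

acc≤cnfAcc : ∀ a r → a ≤ₒ cnfAcc a r
acc≤cnfAcc a []            = ≤-refl a
acc≤cnfAcc a ((β , c) ∷ r) = ≤-trans a (a +ₒ ω^ β ·ₒ fromℕ c) _
  (x≤x+y a (ω^ β ·ₒ fromℕ c)) (acc≤cnfAcc (a +ₒ ω^ β ·ₒ fromℕ c) r)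

cnfAcc<acc+ω^β : ∀ β r a → Decreasing β r → cnfAcc a r <ₒ a +ₒ ω^ β
cnfAcc<acc+ω^β β []             a _         = +-monoʳ-< a zer (ω^ β) (0<ω^ β)
cnfAcc<acc+ω^β β ((β′ , c) ∷ r) a (β′<β , d) = begin-strict
  cnfAcc (a +ₒ M ·ₒ fromℕ c) r   <⟨ cnfAcc<acc+ω^β β′ r (a +ₒ M ·ₒ fromℕ c) d ⟩
  a +ₒ M ·ₒ fromℕ c +ₒ M         ≤⟨ +-assoc-≤ a (M ·ₒ fromℕ c) M ⟩
  a +ₒ M ·ₒ fromℕ (suc c)        ≤⟨ +-monoʳ-≤ a (M ·ₒ fromℕ (suc c)) (ω^ β) (ω^·n≤ω^ β′ β β′<β (suc c)) ⟩
  a +ₒ ω^ β                      ∎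
  where
  open ≤ₒ-Reasoning
  M = ω^ β′

fromℕ≤+⇒split : ∀ m A B → fromℕ m ≤ₒ A +ₒ B →
                Σ ℕ λ m₁ → Σ ℕ λ m₂ → m ℕ.≤ m₁ ℕ.+ m₂ × fromℕ m₁ ≤ₒ A × fromℕ m₂ ≤ₒ B
fromℕ≤+⇒split m       A zer     p = m , 0 , ℕₚ.m≤m+n m 0 , p , tt
fromℕ≤+⇒split zero    A (suc B) p = 0 , 0 , z≤n , tt , tt
fromℕ≤+⇒split (suc m) A (suc B) p with fromℕ≤+⇒split m A B p
... | m₁ , m₂ , m≤ , p₁ , p₂ = m₁ , suc m₂ , ℕₚ.≤-trans (s≤s m≤) (ℕₚ.≤-reflexive (sym (ℕₚ.+-suc m₁ m₂))) , p₁ , p₂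
fromℕ≤+⇒split zero    A (lim h) p = 0 , 0 , z≤n , tt , tt
fromℕ≤+⇒split (suc m) A (lim h) (n , p) with fromℕ≤+⇒split (suc m) A (h n) p
... | m₁ , m₂ , m≤ , p₁ , p₂ = m₁ , m₂ , m≤ , p₁ , ≤-trans (fromℕ m₂) (h n) (lim h) p₂ (f≤lim h n)

-- Stands in for a case split on X ≤ 1, which is undecidable for Brouwer trees.
fromℕ[1+c]≤X·c⇒2≤X : ∀ X c → fromℕ (suc c) ≤ₒ X ·ₒ fromℕ c → fromℕ 2 ≤ₒ X
fromℕ[1+c]≤X·c⇒2≤X X (suc c) p with fromℕ≤+⇒split (suc (suc c)) (X ·ₒ fromℕ c) X p
... | m₁ , m₂ , c+2≤ , p₁ , p₂ with 2 ℕ.≤? m₂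
...   | yes 2≤m₂ = ≤-trans (fromℕ 2) (fromℕ m₂) X (fromℕ-mono-≤ 2≤m₂) p₂
...   | no  2≰m₂ = fromℕ[1+c]≤X·c⇒2≤X X c (≤-trans (fromℕ (suc c)) (fromℕ m₁) _ (fromℕ-mono-≤ c+1≤m₁) p₁)
  where
  c+1≤m₁ : suc c ℕ.≤ m₁
  c+1≤m₁ = ℕₚ.≤-pred (ℕₚ.≤-trans c+2≤ (ℕₚ.≤-trans (ℕₚ.+-monoʳ-≤ m₁ (ℕₚ.≤-pred (ℕₚ.≰⇒> 2≰m₂)))
                                                   (ℕₚ.≤-reflexive (ℕₚ.+-comm m₁ 1))))

ω≤cnf⇒0<β : ∀ β c r → Decreasing β r → ω ≤ₒ cnf β c r → zer <ₒ β
ω≤cnf⇒0<β β c []             _         ω≤ = 1<ω^β⇒0<β β (fromℕ[1+c]≤X·c⇒2≤X (ω^ β) c (ω≤ (suc c)))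
ω≤cnf⇒0<β β c ((β′ , _) ∷ _) (β′<β , _) _ = ≤-<-trans zer β′ β tt β′<β

-- Ranks of finite suborders

module _ (α : Ord) where

  -- Spaced γ a [x₁, …, xₙ]: each of the intervals [a, x₁), [x₁+1, x₂), …, [xₙ+1, α)
  -- has order type at least gap γ.
  Spaced : Ord → Ord → List (Pt α) → Set
  Spaced γ a []      = a +ₒ gap γ ≤ₒ α
  Spaced γ a (x ∷ F) = a +ₒ gap γ ≤ₒ proj₁ x × Spaced γ (suc (proj₁ x)) F

  Spaced-weaken : ∀ γ δ → gap δ ≤ₒ gap γ → ∀ a F → Spaced γ a F → Spaced δ a F
  Spaced-weaken γ δ gapδ≤gapγ a []      s       =
    ≤-trans (a +ₒ gap δ) (a +ₒ gap γ) α (+-monoʳ-≤ a (gap δ) (gap γ) gapδ≤gapγ) s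
  Spaced-weaken γ δ gapδ≤gapγ a (x ∷ F) (s , t) =
    ≤-trans (a +ₒ gap δ) (a +ₒ gap γ) (proj₁ x) (+-monoʳ-≤ a (gap δ) (gap γ) gapδ≤gapγ) s ,
    Spaced-weaken γ δ gapδ≤gapγ (suc (proj₁ x)) F t

  Spaced-lim : ∀ f a F → (∀ n → Spaced (f n) a F) → Spaced (lim f) a F
  Spaced-lim f a []      s = s
  Spaced-lim f a (x ∷ F) s = (λ n → proj₁ (s n)) , Spaced-lim f (suc (proj₁ x)) F (λ n → proj₂ (s n))

  Spaced⇒start≤ : ∀ γ a F → Spaced γ a F → a ≤ₒ α
  Spaced⇒start≤ γ a []      s       = ≤-trans a (a +ₒ gap γ) α (x≤x+y a (gap γ)) s
  Spaced⇒start≤ γ a (x ∷ F) (s , _) =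
    ≤-trans a (proj₁ x) α (≤-trans a (a +ₒ gap γ) (proj₁ x) (x≤x+y a (gap γ)) s) (<⇒≤ (proj₁ x) α (proj₂ x))

  Spaced⇒All≥ : ∀ γ a F → Spaced γ a F → All (λ x → a ≤ₒ proj₁ x) F
  Spaced⇒All≥ γ a []      _       = []
  Spaced⇒All≥ γ a (x ∷ F) (s , t) = a≤x ∷ All-map (λ {z} → ≤-trans a (suc (proj₁ x)) (proj₁ z) a≤suc[x])
                                                 (Spaced⇒All≥ γ (suc (proj₁ x)) F t)
    where
    a≤x = ≤-trans a (a +ₒ gap γ) (proj₁ x) (x≤x+y a (gap γ)) s
    a≤suc[x] = ≤-trans a (proj₁ x) (suc (proj₁ x)) a≤x (x≤suc[x] (proj₁ x))

  Spaced-suc-shift : ∀ γ a F → Spaced (suc γ) a F → Spaced γ (suc (a +ₒ gap γ)) F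
  Spaced-suc-shift γ a []      s       = ≤-trans (suc (a +ₒ gap γ) +ₒ gap γ) (a +ₒ gap (suc γ)) α (+-assoc-≤ a (suc (gap γ)) (gap γ)) s
  Spaced-suc-shift γ a (x ∷ F) (s , t) =
    ≤-trans (suc (a +ₒ gap γ) +ₒ gap γ) (a +ₒ gap (suc γ)) (proj₁ x) (+-assoc-≤ a (suc (gap γ)) (gap γ)) s ,
    Spaced-weaken (suc γ) γ (gap-≤-suc γ) (suc (proj₁ x)) F t

  Spaced-suc⇒point : ∀ γ a L R → Spaced (suc γ) a (L ++ R) →
                     Σ (Pt α) λ y → All (λ x → Lt α x y) L × All (λ z → Lt α y z) R × Spaced γ a (L ++ y ∷ R)
  Spaced-suc⇒point γ a [] R s =
    (y , Spaced⇒start≤ γ (suc y) R s′) , [] , Spaced⇒All≥ γ (suc y) R s′ , ≤-refl y , s′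
    where
    y = a +ₒ gap γ
    s′ = Spaced-suc-shift γ a R s
  Spaced-suc⇒point γ a (x ∷ L) R (a+gap≤x , s) with Spaced-suc⇒point γ (suc (proj₁ x)) L R s
  ... | y , L<y , y<R , s′ = y , x<y ∷ L<y , y<R , a+gap≤x′ , s′
    where
    x<y : Lt α x y
    x<y with ++⁻ʳ L (Spaced⇒All≥ γ (suc (proj₁ x)) (L ++ y ∷ R) s′)
    ... | x<y ∷ _ = x<y
    a+gap≤x′ = ≤-trans (a +ₒ gap γ) (a +ₒ gap (suc γ)) (proj₁ x)
                 (+-monoʳ-≤ a (gap γ) (gap (suc γ)) (gap-≤-suc γ)) a+gap≤x

  Spaced⇒rk≥ : ∀ γ F → Spaced γ zer F → rk≥ α γ F
  Spaced⇒rk≥ zer     F s = tt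
  Spaced⇒rk≥ (suc γ) F s L R refl with Spaced-suc⇒point γ zer L R s
  ... | y , L<y , y<R , s′ = y , L<y , y<R , Spaced⇒rk≥ γ (L ++ y ∷ R) s′
  Spaced⇒rk≥ (lim f) F s n =
    Spaced⇒rk≥ (f n) F (Spaced-weaken (lim f) (f n) (f≤lim (λ m → gap (f m)) n) zer F s)

  Spaced-insert : ∀ a L R (y : Pt α) → Spaced zer a (L ++ R) → a ≤ₒ proj₁ y →
                  All (λ x → Lt α x y) L → All (λ z → Lt α y z) R → Spaced zer a (L ++ y ∷ R)
  Spaced-insert a []      []      y _       a≤y _           _         = a≤y , proj₂ y
  Spaced-insert a []      (z ∷ R) y (_ , s) a≤y _           (y<z ∷ _) = a≤y , y<z , s
  Spaced-insert a (x ∷ L) R       y (a≤x , s) _ (x<y ∷ L<y) y<R       =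
    a≤x , Spaced-insert (suc (proj₁ x)) L R y s x<y L<y y<R

  gapStart : Ord → List (Pt α) → Ord
  gapStart a []      = a
  gapStart a (x ∷ L) = gapStart (suc (proj₁ x)) L

  gapEnd : List (Pt α) → Ord
  gapEnd []      = α
  gapEnd (z ∷ _) = proj₁ z

  Spaced⇒head : ∀ γ a R → Spaced γ a R → a +ₒ gap γ ≤ₒ gapEnd R
  Spaced⇒head γ a []      s       = s
  Spaced⇒head γ a (_ ∷ _) (s , _) = s

  Spaced⇒around : ∀ γ a L y R → Spaced γ a (L ++ y ∷ R) →
                  gapStart a L +ₒ gap γ ≤ₒ proj₁ y × suc (proj₁ y) +ₒ gap γ ≤ₒ gapEnd R
  Spaced⇒around γ a []      y R (s , t) = s , Spaced⇒head γ (suc (proj₁ y)) R t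
  Spaced⇒around γ a (x ∷ L) y R (_ , t) = Spaced⇒around γ (suc (proj₁ x)) L y R t

  gaps⇒Spaced : ∀ γ a F → (∀ L R → F ≡ L ++ R → gapStart a L +ₒ gap γ ≤ₒ gapEnd R) → Spaced γ a F
  gaps⇒Spaced γ a []      gaps = gaps [] [] refl
  gaps⇒Spaced γ a (x ∷ F) gaps =
    gaps [] (x ∷ F) refl , gaps⇒Spaced γ (suc (proj₁ x)) F (λ L R F≡ → gaps (x ∷ L) R (cong (x ∷_) F≡))

  rk≥⇒Spaced : ∀ γ F → Spaced zer zer F → rk≥ α γ F → Spaced γ zer F
  rk≥⇒Spaced zer     F s _  = s
  rk≥⇒Spaced (suc γ) F s rk = gaps⇒Spaced (suc γ) zer F gap-around
    where
    gap-around : ∀ L R → F ≡ L ++ R → gapStart zer L +ₒ gap (suc γ) ≤ₒ gapEnd R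
    gap-around L R F≡ with rk L R F≡
    ... | y , L<y , y<R , rk′ = begin
      gapStart zer L +ₒ gap (suc γ)          ≤⟨ +-assoc-≥ (gapStart zer L) (suc (gap γ)) (gap γ) ⟩
      suc (gapStart zer L +ₒ gap γ) +ₒ gap γ ≤⟨ +-monoˡ-≤ _ (suc (proj₁ y)) (gap γ) before ⟩
      suc (proj₁ y) +ₒ gap γ                 ≤⟨ after ⟩
      gapEnd R                               ∎
      where
      open ≤ₒ-Reasoning
      s′ = Spaced-insert zer L R y (subst (Spaced zer zer) F≡ s) tt L<y y<R
      around = Spaced⇒around γ zer L y R (rk≥⇒Spaced γ (L ++ y ∷ R) s′ rk′)
      before = proj₁ around
      after = proj₂ around
  rk≥⇒Spaced (lim f) F s rk = Spaced-lim f zer F (λ n → rk≥⇒Spaced (f n) F s (rk n))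

  gap≤⇒rk≥ : ∀ γ → gap γ ≤ₒ α → rk≥ α γ []
  gap≤⇒rk≥ γ gap≤α = Spaced⇒rk≥ γ [] (≤-trans (zer +ₒ gap γ) (gap γ) α (0+x≤x (gap γ)) gap≤α)

  rk≥⇒gap≤ : ∀ γ → rk≥ α γ [] → gap γ ≤ₒ α
  rk≥⇒gap≤ γ rk = ≤-trans (gap γ) (zer +ₒ gap γ) α (x≤0+x (gap γ)) (rk≥⇒Spaced γ [] tt rk)

-- The coefficients c₂, …, cₗ do not matter: the tail of the normal form stays below ω^β₁.
theorem6p13 : (β₁ : Ord) (c₁ : ℕ) (rest : List (Ord × ℕ)) →
              1 ℕ.≤ c₁ → All (λ p → 1 ℕ.≤ proj₂ p) rest → Decreasing β₁ rest →
              ω ≤ₒ cnf β₁ c₁ rest →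
              RankIs (cnf β₁ c₁ rest) (ω ·ₒ β₁ +ₒ fromℕ ⌊log₂ c₁ ⌋)
theorem6p13 β₁ c₁ rest 1≤c₁ _ dec ω≤α = gap≤⇒rk≥ α γ gap[γ]≤α , λ rk → gap[1+γ]≰α (rk≥⇒gap≤ α (suc γ) rk)
  where
  open ≤ₒ-Reasoning
  α = cnf β₁ c₁ rest
  M = ω^ β₁
  k = ⌊log₂ c₁ ⌋
  γ = ω ·ₒ β₁ +ₒ fromℕ k
  0<β₁ = ω≤cnf⇒0<β β₁ c₁ rest dec ω≤α

  gap[γ]≤α : gap γ ≤ₒ α
  gap[γ]≤α = begin
    gap γ                 ≤⟨ gap[ω·β+n]≤ω^β·2ⁿ β₁ 0<β₁ k ⟩
    M ·ₒ fromℕ (2 ^ k)    ≤⟨ ·-monoʳ-≤ M (2^⌊log₂n⌋≤n c₁ 1≤c₁) ⟩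
    M ·ₒ fromℕ c₁         ≤⟨ acc≤cnfAcc (M ·ₒ fromℕ c₁) rest ⟩
    α                     ∎

  gap[1+γ]≰α : ¬ gap (suc γ) ≤ₒ α
  gap[1+γ]≰α gap≤α = begin-contradiction
    M ·ₒ fromℕ (2 ^ suc k)   ≤⟨ ω^β·2ⁿ≤gap[ω·β+n] β₁ 0<β₁ (suc k) ⟩
    gap (suc γ)              ≤⟨ gap≤α ⟩
    α                        <⟨ cnfAcc<acc+ω^β β₁ rest (M ·ₒ fromℕ c₁) dec ⟩
    M ·ₒ fromℕ (suc c₁)      ≤⟨ ·-monoʳ-≤ M (n<2^[1+⌊log₂n⌋] c₁) ⟩
    M ·ₒ fromℕ (2 ^ suc k)   ∎
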